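{- Let $n\ge 2$ and let $F$ be the $n$-cell null-boundary non-uniform cellular automaton with rule vector $\langle \mathcal{R}_0,\dots,\mathcal{R}_{n-1}\rangle$. Let $S=(s_0,\dots,s_{n-1})$ and $D=(d_0,\dots,d_{n-1})$ be configurations in $\{0,1\}^n$. For $0\le i\le n-1$ let $\delta_i=E_{i.b_i}$ be the level-$i$ edge of the reachability tree whose index $b_i$ has binary representation $d_0d_1\cdots d_i$. If for some $i$ with $0\le i\le n-1$ the edge $\delta_i$ is non-reachable (i.e. its label $l_{i.b_i}$ is empty), then $D$ is not reachable from $S$.
   Context: A rule is a map $\{0,1\}^3\to\{0,1\}$. A triple $(a,b,c)\in\{0,1\}^3$ is called a rule min term (RMT) and is identified with the integer $4a+2b+c\in\{0,\dots,7\}$; $\mathcal{R}[r]$ denotes the value of rule $\mathcal{R}$ on RMT $r$. The $n$-cell null-boundary non-uniform CA with rule vector $\langle \mathcal{R}_0,\dots,\mathcal{R}_{n-1}\rangle$ is the map $F:\{0,1\}^n\to\{0,1\}^n$, $F(x)_i=\mathcal{R}_i[4x_{i-1}+2x_i+x_{i+1}]$ for $0\le i\le n-1$, with the convention $x_{ -1}=x_n=0$. A configuration $D$ is reachable from $S$ if $D=F^t(S)$ for some integer $t\ge 1$. Reachability tree edges and labels: for $0\le i\le n-1$ the edges of level $i$ are $E_{i.j}$, $0\le j\le 2^{i+1}-1$, where $E_{i.j}$ is identified with the bit string $b_0b_1\cdots b_i$ that is the $(i+1)$-bit binary representation of $j$ ($b_0$ most significant). Call a tuple $(x_0,\dots,x_{i+1})\in\{0,1\}^{i+2}$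 (with $x_{i+1}=0$ required when $i=n-1$, and $x_{ -1}:=0$) a witness for $E_{i.j}$ if $\mathcal{R}_m[4x_{m-1}+2x_m+x_{m+1}]=b_m$ for all $0\le m\le i$; its RMT is $4x_{i-1}+2x_i+x_{i+1}$. The label $l_{i.j}$ is the set of RMTs of witnesses for $E_{i.j}$; the edge $E_{i.j}$ is non-reachable if $l_{i.j}=\emptyset$. -}

module Defs where

open import Data.Nat using (ℕ; zero; suc; _+_; _∸_; _≤_)
open import Data.Bool using (Bool; true; false)
open import Data.Fin using (Fin; toℕ)
open import Data.Vec using (Vec; []; _∷_; lookup; tabulate)
open import Data.Product using (Σ; _×_; _,_)
open import Relation.Binary.PropositionalEquality using (_≡_)
open import Relation.Nullary using (¬_)

-- An RMT (a,b,c) is identified with the integer 4a+2b+c ∈ {0,…,7}.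
RMT : Set
RMT = Fin 8

rmt : Bool → Bool → Bool → RMT
rmt false false false = Data.Fin.zero
rmt false false true  = Data.Fin.suc Data.Fin.zero
rmt false true  false = Data.Fin.suc (Data.Fin.suc Data.Fin.zero)
rmt false true  true  = Data.Fin.suc (Data.Fin.suc (Data.Fin.suc Data.Fin.zero))
rmt true  false false = Data.Fin.suc (Data.Fin.suc (Data.Fin.suc (Data.Fin.suc Data.Fin.zero)))
rmt true  false true  = Data.Fin.suc (Data.Fin.suc (Data.Fin.suc (Data.Fin.suc (Data.Fin.suc Data.Fin.zero))))
rmt true  true  false = Data.Fin.suc (Data.Fin.suc (Data.Fin.suc (Data.Fin.suc (Data.Fin.suc (Data.Fin.suc Data.Fin.zero)))))
rmt true  true  true  = Data.Fin.suc (Data.Fin.suc (Data.Fin.suc (Data.Fin.suc (Data.Fin.suc (Data.Fin.suc (Data.Fin.suc Data.Fin.zero))))))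

Rule : Set
Rule = RMT → Bool

-- Cell access with null boundary: out-of-range indices read 0 (false).
at : ∀ {k} → Vec Bool k → ℕ → Bool
at [] _ = false
at (b ∷ _) zero = b
at (_ ∷ xs) (suc k) = at xs k

atL : ∀ {k} → Vec Bool k → ℕ → Bool
atL x zero = false
atL x (suc m) = at x m

step : ∀ {n} → Vec Rule n → Vec Bool n → Vec Bool n
step R x = tabulate λ i → lookup R i (rmt (atL x (toℕ i)) (lookup x i) (at x (suc (toℕ i))))

iter : ∀ {A : Set} → (A → A) → ℕ → A → A
iter f zero a = a
iter f (suc t) a = f (iter f t a)

Reachable : ∀ {n} → Vec Rule n → Vec Bool n → Vec Bool n → Set
Reachable R S D = Σ ℕ λ t → (1 ≤ t) × (iter (step R) t S ≡ D)

-- Edges of level i of the reachability tree are identified with bit strings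
-- b_0 … b_i (the (i+1)-bit binary representation of the index j).
Edge : ∀ {n} → Fin n → Set
Edge i = Vec Bool (suc (toℕ i))

IsWitness : ∀ {n} → Vec Rule n → (i : Fin n) → Edge i → Vec Bool (suc (suc (toℕ i))) → Set
IsWitness {n} R i b x =
  (toℕ i ≡ n ∸ 1 → at x (suc (toℕ i)) ≡ false) ×
  ((m : Fin n) → toℕ m ≤ toℕ i →
     lookup R m (rmt (atL x (toℕ m)) (at x (toℕ m)) (at x (suc (toℕ m)))) ≡ at b (toℕ m))

witnessRMT : ∀ {n} (i : Fin n) → Vec Bool (suc (suc (toℕ i))) → RMT
witnessRMT i x = rmt (atL x (toℕ i)) (at x (toℕ i)) (at x (suc (toℕ i)))

-- r ∈ l_{i.j}: the label is the set of RMTs of witnesses.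
InLabel : ∀ {n} → Vec Rule n → (i : Fin n) → Edge i → RMT → Set
InLabel R i b r = Σ (Vec Bool (suc (suc (toℕ i)))) λ x → IsWitness R i b x × (witnessRMT i x ≡ r)

NonReachableEdge : ∀ {n} → Vec Rule n → (i : Fin n) → Edge i → Set
NonReachableEdge R i b = (r : RMT) → ¬ InLabel R i b r

prefixEdge : ∀ {n} → Vec Bool n → (i : Fin n) → Edge i
prefixEdge D i = tabulate λ k → at D (toℕ k)

{-# OPTIONS --safe #-}
module Submission where

open import Defs
open import Data.Nat using (ℕ; zero; suc; _≤_; _<_; _∸_; s≤s)
open import Data.Nat.Properties using (≤-refl; ≤-trans; n≤1+n; m≤n+m∸n)
open import Data.Bool using (Bool; false)
open import Data.Fin using (Fin; toℕ)
open import Data.Vec using (Vec; []; _∷_; lookup; tabulate)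
open import Data.Vec.Properties using (lookup∘tabulate)
open import Data.Product using (Σ; _,_)
open import Relation.Nullary using (¬_)
open import Relation.Binary.PropositionalEquality using (_≡_; refl; sym; cong; subst; module ≡-Reasoning)

-- If D = F(X), the first i+2 cells of X form a witness for the edge δ_i of D,
-- so δ_i has a nonempty label. Hence an empty label at any level rules out
-- D = F^t(S) for every t ≥ 1.

at-tabulate : ∀ {k} (g : ℕ → Bool) {m} → m < k → at (tabulate {n = k} (λ j → g (toℕ j))) m ≡ g m
at-tabulate {suc k} g {zero}  _       = refl
at-tabulate {suc k} g {suc m} (s≤s p) = at-tabulate (λ j → g (suc j)) p

at-toℕ : ∀ {n} (X : Vec Bool n) (m : Fin n) → at X (toℕ m) ≡ lookup X m
at-toℕ (x ∷ X) Fin.zero    = refl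
at-toℕ (x ∷ X) (Fin.suc m) = at-toℕ X m

at-≥-length : ∀ {n} (X : Vec Bool n) {m} → n ≤ m → at X m ≡ false
at-≥-length []      _       = refl
at-≥-length (x ∷ X) (s≤s p) = at-≥-length X p

prefix : ∀ {n} → Vec Bool n → (k : ℕ) → Vec Bool k
prefix X k = tabulate λ j → at X (toℕ j)

at-prefix : ∀ {n} (X : Vec Bool n) {k m} → m < k → at (prefix X k) m ≡ at X m
at-prefix X = at-tabulate (at X)

atL-prefix : ∀ {n} (X : Vec Bool n) {k m} → m < k → atL (prefix X k) m ≡ atL X m
atL-prefix X {m = zero}  _ = refl
atL-prefix X {m = suc m} p = at-prefix X (≤-trans (n≤1+n _) p)

rmtAt : ∀ {k} → Vec Bool k → ℕ → RMT
rmtAt X m = rmt (atL X m) (at X m) (at X (suc m))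

rmtAt-prefix : ∀ {n} (X : Vec Bool n) {k m} → suc m < k → rmtAt (prefix X k) m ≡ rmtAt X m
rmtAt-prefix X {m = m} p
  rewrite atL-prefix X {m = m} (≤-trans (n≤1+n _) p)
        | at-prefix X {m = m} (≤-trans (n≤1+n _) p)
        | at-prefix X {m = suc m} p
  = refl

lookup-step : ∀ {n} (R : Vec Rule n) (X : Vec Bool n) (m : Fin n) →
  lookup (step R X) m ≡ lookup R m (rmtAt X (toℕ m))
lookup-step R X m = begin
  lookup (step R X) m
    ≡⟨ lookup∘tabulate _ m ⟩
  lookup R m (rmt (atL X (toℕ m)) (lookup X m) (at X (suc (toℕ m))))
    ≡⟨ cong (λ c → lookup R m (rmt (atL X (toℕ m)) c (at X (suc (toℕ m))))) (sym (at-toℕ X m)) ⟩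
  lookup R m (rmtAt X (toℕ m)) ∎
  where open ≡-Reasoning

prefix-isWitness : ∀ {n} (R : Vec Rule n) (X : Vec Bool n) (i : Fin n) →
  IsWitness R i (prefixEdge (step R X) i) (prefix X (suc (suc (toℕ i))))
prefix-isWitness {n} R X i = boundary , rules
  where
  boundary : toℕ i ≡ n ∸ 1 → at (prefix X (suc (suc (toℕ i)))) (suc (toℕ i)) ≡ false
  boundary i≡n-1 = begin
    at (prefix X (suc (suc (toℕ i)))) (suc (toℕ i))
      ≡⟨ at-prefix X ≤-refl ⟩
    at X (suc (toℕ i))
      ≡⟨ at-≥-length X (subst (λ j → n ≤ suc j) (sym i≡n-1) (m≤n+m∸n n 1)) ⟩
    false ∎
    where open ≡-Reasoning

  rules : (m : Fin n) → toℕ m ≤ toℕ i →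
    lookup R m (rmtAt (prefix X (suc (suc (toℕ i)))) (toℕ m)) ≡ at (prefixEdge (step R X) i) (toℕ m)
  rules m m≤i = begin
    lookup R m (rmtAt (prefix X (suc (suc (toℕ i)))) (toℕ m))
      ≡⟨ cong (lookup R m) (rmtAt-prefix X (s≤s (s≤s m≤i))) ⟩
    lookup R m (rmtAt X (toℕ m))
      ≡⟨ sym (lookup-step R X m) ⟩
    lookup (step R X) m
      ≡⟨ sym (at-toℕ (step R X) m) ⟩
    at (step R X) (toℕ m)
      ≡⟨ sym (at-prefix (step R X) (s≤s m≤i)) ⟩
    at (prefixEdge (step R X) i) (toℕ m) ∎
    where open ≡-Reasoning

prefixEdge-step-reachable : ∀ {n} (R : Vec Rule n) (X : Vec Bool n) (i : Fin n) →
  ¬ NonReachableEdge R i (prefixEdge (step R X) i)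
prefixEdge-step-reachable R X i empty =
  empty _ (prefix X _ , prefix-isWitness R X i , refl)

mainTheorem2 : (n : ℕ) → 2 ≤ n → (R : Vec Rule n) → (S D : Vec Bool n) →
    Σ (Fin n) (λ i → NonReachableEdge R i (prefixEdge D i)) →
    ¬ Reachable R S D
mainTheorem2 n _ R S D (i , empty) (suc t , _ , refl) =
  prefixEdge-step-reachable R (iter (step R) t S) i empty
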